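{- Let $H$ be a Hadamard matrix of order $n$ and let $d\ge 2$. For $\ell\in[n]$ let $C_\ell$ be the $d$-dimensional hypercube of order $n$ with $C_\ell(i_1,\dots,i_d)=\prod_{j=1}^d H(\ell,i_j)$ for $i_1,\dots,i_d\in[n]$. Then $\{C_\ell:\ell\in[n]\}$ is an $(n,d)$-orthogonal family.
   Context: A Hadamard matrix of order $n$ is an $n\times n$ $\pm1$-matrix $H$ with $HH^\top=nI$. For a $d$-dimensional hypercube $A$ of order $n$ (cells indexed by $[n]^d$), $i\in[d]$ and $a\in[n]$, $A_{i;a}$ is the $(d-1)$-dimensional sub-array obtained by fixing the $i$-th coordinate to $a$. The dot product of two arrays of the same shape is the sum of products of corresponding entries. An $(n,d)$-orthogonal family is a collection $\mathcal S$ of $n$ $d$-dimensional $\pm1$-hypercubes of order $n$ such that (O1) $A_{i;a}\cdot B_{i;b}=0$ for all distinct $A,B\in\mathcal S$, all $i\in[d]$ and all $a,b\in[n]$; and (O2) $\sum_{A\in\mathcal S}A_{i;a}\cdot A_{i;b}=0$ for all $i\in[d]$ and distinct $a,b\in[n]$. -}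

module Defs where

open import Data.Nat using (ℕ; zero; suc)
open import Data.Fin using (Fin; zero; suc)
open import Data.Integer using (ℤ; _+_; _*_; 0ℤ; 1ℤ; -_)
open import Data.Vec.Functional using (Vector; insertAt)
open import Data.Product using (_×_)
open import Data.Sum using (_⊎_)
open import Relation.Binary.PropositionalEquality using (_≡_; _≢_)

∑ : ∀ {n} → (Fin n → ℤ) → ℤ
∑ {zero}  f = 0ℤ
∑ {suc n} f = f zero + ∑ (λ i → f (suc i))

∑cells : ∀ {n d} → ((Fin d → Fin n) → ℤ) → ℤ
∑cells {n} {zero}  f = f (λ ())
∑cells {n} {suc d} f = ∑ {n} (λ a → ∑cells {n} {d} (λ y → f (insertAt y zero a)))

IsPM1 : ℤ → Set
IsPM1 x = (x ≡ 1ℤ) ⊎ (x ≡ - 1ℤ)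

Matrix : ℕ → Set
Matrix n = Fin n → Fin n → ℤ

IsHadamard : ∀ n → Matrix n → Set
IsHadamard n H =
  (∀ i j → IsPM1 (H i j)) ×
  (∀ i k → ∑ (λ j → H i j * H k j) ≡ (if-eq i k))
  where
    open import Data.Fin using (_≟_)
    open import Relation.Nullary using (yes; no)
    if-eq : Fin n → Fin n → ℤ
    if-eq i k with i ≟ k
    ... | yes _ = Data.Integer.+ n
    ... | no  _ = 0ℤ

Hypercube : ℕ → ℕ → Set
Hypercube n d = (Fin d → Fin n) → ℤ

IsPM1Cube : ∀ {n d} → Hypercube n d → Set
IsPM1Cube A = ∀ x → IsPM1 (A x)

slice : ∀ {n m} → Hypercube n (suc m) → Fin (suc m) → Fin n → Hypercube n m
slice A i a y = A (insertAt y i a)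

_·_ : ∀ {n d} → Hypercube n d → Hypercube n d → ℤ
A · B = ∑cells (λ x → A x * B x)

-- (n, suc m)-orthogonal family, given as an indexing S : Fin n → cubes
-- (a collection of n cubes; "distinct A, B" = distinct indices)
IsOrthogonalFamily : ∀ n m → (Fin n → Hypercube n (suc m)) → Set
IsOrthogonalFamily n m S =
  (∀ ℓ → IsPM1Cube (S ℓ)) ×
  (∀ ℓ ℓ' → ℓ ≢ ℓ' → ∀ i a b → slice (S ℓ) i a · slice (S ℓ') i b ≡ 0ℤ) ×
  (∀ ℓ ℓ' → ℓ ≢ ℓ' → S ℓ ≢ S ℓ') ×
  (∀ i a b → a ≢ b → ∑ (λ ℓ → slice (S ℓ) i a · slice (S ℓ) i b) ≡ 0ℤ)

∏ : ∀ {d} → (Fin d → ℤ) → ℤ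
∏ {zero}  f = 1ℤ
∏ {suc d} f = f zero * ∏ (λ j → f (suc j))

productCube : ∀ {n} d → Matrix n → Fin n → Hypercube n d
productCube d H ℓ x = ∏ {d} (λ j → H ℓ (x j))

{-# OPTIONS --safe #-}
module Submission where

-- C_ℓ is the d-th tensor power of the row H_ℓ, so slice dot products factor:
-- (C_ℓ)_{i;a} · (C_ℓ′)_{i;b} = H(ℓ,a) H(ℓ′,b) ⟨H_ℓ,H_ℓ′⟩^(d-1).  Orthogonality of
-- the rows gives (O1) and distinctness; (O2) needs orthogonality of the columns.
-- That follows from HHᵀ = nI without inverting H: HᵀH and HHᵀ have the same sum
-- of squared entries (both are tr((HHᵀ)²)) and the same diagonal (all n), so the
-- off-diagonal entries of HᵀH have square sum 0.

open import Defs
open import Data.Nat using (ℕ; zero; suc; _≤_; z≤n)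
open import Data.Fin using (Fin; zero; suc; punchIn; punchOut)
open import Data.Fin.Properties using (_≟_; punchInᵢ≢i; punchIn-punchOut)
open import Data.Integer using (ℤ; +_; -[1+_]; +≤+; 0ℤ; 1ℤ; _+_; _*_; _^_) renaming (_≤_ to _≤ℤ_)
import Data.Integer.Properties as ℤ
open import Data.Vec.Functional using (Vector; insertAt; removeAt)
open import Data.Product using (_,_)
open import Data.Sum using (inj₁; inj₂; [_,_]′)
open import Function using (flip; id; _∘_)
open import Relation.Nullary using (yes; no)
open import Relation.Nullary.Negation using (contradiction)
open import Relation.Binary.PropositionalEquality
open import Algebra.Bundles using (AbelianGroup)
import Algebra.Properties.Semiring.Sum ℤ.+-*-semiring as Sum
open import Algebra.Properties.CommutativeSemigroup ℤ.*-commutativeSemigroup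
  using (interchange; x∙yz≈y∙xz)
open import Algebra.Properties.Group (AbelianGroup.group ℤ.+-0-abelianGroup)
  using (identityʳ-unique)

∑≡sum : ∀ {n} (f : Vector ℤ n) → ∑ f ≡ Sum.sum f
∑≡sum {zero}  f = refl
∑≡sum {suc n} f = cong (_+_ (f zero)) (∑≡sum (f ∘ suc))

∑-cong : ∀ {n} {f g : Vector ℤ n} → (∀ i → f i ≡ g i) → ∑ f ≡ ∑ g
∑-cong {f = f} {g} f≗g = trans (∑≡sum f) (trans (Sum.sum-cong-≗ f≗g) (sym (∑≡sum g)))

∑-zero : ∀ {n} → ∑ {n} (λ _ → 0ℤ) ≡ 0ℤ
∑-zero {n} = trans (∑≡sum {n} (λ _ → 0ℤ)) (Sum.sum-replicate-zero n)

∑-*ˡ : ∀ {n} c (f : Vector ℤ n) → c * ∑ f ≡ ∑ (λ i → c * f i)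
∑-*ˡ c f =
  trans (cong (c *_) (∑≡sum f)) (trans (Sum.*-distribˡ-sum c f) (sym (∑≡sum (λ i → c * f i))))

∑-*ʳ : ∀ {n} c (f : Vector ℤ n) → ∑ f * c ≡ ∑ (λ i → f i * c)
∑-*ʳ c f =
  trans (cong (_* c) (∑≡sum f)) (trans (Sum.*-distribʳ-sum c f) (sym (∑≡sum (λ i → f i * c))))

∑-distrib-+ : ∀ {n} (f g : Vector ℤ n) → ∑ (λ i → f i + g i) ≡ ∑ f + ∑ g
∑-distrib-+ f g = trans (∑≡sum (λ i → f i + g i))
  (trans (Sum.∑-distrib-+ f g) (sym (cong₂ _+_ (∑≡sum f) (∑≡sum g))))

∑-remove : ∀ {n} (f : Vector ℤ (suc n)) i → ∑ f ≡ f i + ∑ (removeAt f i)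
∑-remove f i =
  trans (∑≡sum f) (trans (Sum.sum-remove f) (cong (_+_ (f i)) (sym (∑≡sum (removeAt f i)))))

∑∑≡sum-sum : ∀ {m n} (f : Fin m → Vector ℤ n) →
  ∑ (λ i → ∑ (f i)) ≡ Sum.sum (λ i → Sum.sum (f i))
∑∑≡sum-sum f = trans (∑≡sum (λ i → ∑ (f i))) (Sum.sum-cong-≗ (λ i → ∑≡sum (f i)))

∑-comm : ∀ {m n} (f : Fin m → Fin n → ℤ) → ∑ (λ i → ∑ (f i)) ≡ ∑ (λ j → ∑ (λ i → f i j))
∑-comm f = trans (∑∑≡sum-sum f) (trans (Sum.∑-comm f) (sym (∑∑≡sum-sum (flip f))))

∑*∑ : ∀ {m n} (f : Vector ℤ m) (g : Vector ℤ n) → ∑ f * ∑ g ≡ ∑ (λ i → ∑ (λ j → f i * g j))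
∑*∑ f g = trans (∑-*ʳ (∑ g) f) (∑-cong (λ i → ∑-*ˡ (f i) g))

∑∑-comm : ∀ {a b c d} (F : Fin a → Fin b → Fin c → Fin d → ℤ) →
  ∑ (λ i → ∑ (λ j → ∑ (λ k → ∑ (λ l → F i j k l)))) ≡
  ∑ (λ k → ∑ (λ l → ∑ (λ i → ∑ (λ j → F i j k l))))
∑∑-comm F = begin
  ∑ (λ i → ∑ (λ j → ∑ (λ k → ∑ (λ l → F i j k l))))
    ≡⟨ ∑-cong (λ i → ∑-comm (λ j k → ∑ (F i j k))) ⟩
  ∑ (λ i → ∑ (λ k → ∑ (λ j → ∑ (λ l → F i j k l))))
    ≡⟨ ∑-comm (λ i k → ∑ (λ j → ∑ (F i j k))) ⟩
  ∑ (λ k → ∑ (λ i → ∑ (λ j → ∑ (λ l → F i j k l))))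
    ≡⟨ ∑-cong (λ k → ∑-cong (λ i → ∑-comm (λ j l → F i j k l))) ⟩
  ∑ (λ k → ∑ (λ i → ∑ (λ l → ∑ (λ j → F i j k l))))
    ≡⟨ ∑-cong (λ k → ∑-comm (λ i l → ∑ (λ j → F i j k l))) ⟩
  ∑ (λ k → ∑ (λ l → ∑ (λ i → ∑ (λ j → F i j k l)))) ∎
  where open ≡-Reasoning

∑-nonneg : ∀ {n} (f : Vector ℤ n) → (∀ i → 0ℤ ≤ℤ f i) → 0ℤ ≤ℤ ∑ f
∑-nonneg {zero}  f 0≤f = ℤ.≤-refl
∑-nonneg {suc n} f 0≤f = ℤ.+-mono-≤ (0≤f zero) (∑-nonneg (f ∘ suc) (0≤f ∘ suc))

∑-nonneg-≡0⇒≡0 : ∀ {n} (f : Vector ℤ n) → (∀ i → 0ℤ ≤ℤ f i) → ∑ f ≡ 0ℤ → ∀ i → f i ≡ 0ℤ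
∑-nonneg-≡0⇒≡0 {suc n} f 0≤f ∑f≡0 i = ℤ.≤-antisym fᵢ≤0 (0≤f i)
  where
  open ℤ.≤-Reasoning
  fᵢ≤0 : f i ≤ℤ 0ℤ
  fᵢ≤0 = begin
    f i                     ≡⟨ ℤ.+-identityʳ (f i) ⟨
    f i + 0ℤ                ≤⟨ ℤ.+-monoʳ-≤ (f i) (∑-nonneg (removeAt f i) (0≤f ∘ _)) ⟩
    f i + ∑ (removeAt f i)  ≡⟨ ∑-remove f i ⟨
    ∑ f                     ≡⟨ ∑f≡0 ⟩
    0ℤ                      ∎

_² : ℤ → ℤ
x ² = x * x

0≤i² : ∀ i → 0ℤ ≤ℤ i ²
0≤i² (+ zero)  = +≤+ z≤n
0≤i² (+ suc n) = +≤+ z≤n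
0≤i² -[1+ n ]  = +≤+ z≤n

i²≡0⇒i≡0 : ∀ i → i ² ≡ 0ℤ → i ≡ 0ℤ
i²≡0⇒i≡0 i i²≡0 = [ id , id ]′ (ℤ.i*j≡0⇒i≡0∨j≡0 i i²≡0)

IsPM1⇒²≡1 : ∀ {x} → IsPM1 x → x ² ≡ 1ℤ
IsPM1⇒²≡1 (inj₁ refl) = refl
IsPM1⇒²≡1 (inj₂ refl) = refl

IsPM1-* : ∀ {x y} → IsPM1 x → IsPM1 y → IsPM1 (x * y)
IsPM1-* (inj₁ refl) (inj₁ refl) = inj₁ refl
IsPM1-* (inj₁ refl) (inj₂ refl) = inj₂ refl
IsPM1-* (inj₂ refl) (inj₁ refl) = inj₂ refl
IsPM1-* (inj₂ refl) (inj₂ refl) = inj₁ refl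

IsPM1-∏ : ∀ {d} (f : Vector ℤ d) → (∀ j → IsPM1 (f j)) → IsPM1 (∏ f)
IsPM1-∏ {zero}  f pm = inj₁ refl
IsPM1-∏ {suc d} f pm = IsPM1-* (pm zero) (IsPM1-∏ (f ∘ suc) (pm ∘ suc))

⟨_,_⟩ : ∀ {n} → Vector ℤ n → Vector ℤ n → ℤ
⟨ u , v ⟩ = ∑ (λ k → u k * v k)

∑-ones : ∀ {n} → ∑ {n} (λ _ → 1ℤ) ≡ + n
∑-ones {zero}  = refl
∑-ones {suc n} = cong (_+_ 1ℤ) (∑-ones {n})

IsPM1⇒⟨u,u⟩≡n : ∀ {n} (u : Vector ℤ n) → (∀ k → IsPM1 (u k)) → ⟨ u , u ⟩ ≡ + n
IsPM1⇒⟨u,u⟩≡n u pm = trans (∑-cong (IsPM1⇒²≡1 ∘ pm)) ∑-ones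

gram : ∀ {k n} → (Fin k → Vector ℤ n) → Matrix k
gram A i j = ⟨ A i , A j ⟩

IsDiagonal : ∀ {k} → Matrix k → Set
IsDiagonal M = ∀ {i j} → i ≢ j → M i j ≡ 0ℤ

‖_‖² : ∀ {k} → Matrix k → ℤ
‖ M ‖² = ∑ (λ i → ∑ (λ j → M i j ²))

‖diag_‖² : ∀ {k} → Matrix k → ℤ
‖diag M ‖² = ∑ (λ i → M i i ²)

offDiagonal² : ∀ {k} → Matrix (suc k) → Vector ℤ (suc k)
offDiagonal² M i = ∑ (removeAt (λ j → M i j ²) i)

‖‖²-split : ∀ {k} (M : Matrix (suc k)) → ‖ M ‖² ≡ ‖diag M ‖² + ∑ (offDiagonal² M)
‖‖²-split M =
  trans (∑-cong (λ i → ∑-remove (λ j → M i j ²) i)) (∑-distrib-+ (λ i → M i i ²) (offDiagonal² M))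

IsDiagonal⇒‖‖²≡‖diag‖² : ∀ {k} (M : Matrix k) → IsDiagonal M → ‖ M ‖² ≡ ‖diag M ‖²
IsDiagonal⇒‖‖²≡‖diag‖² {zero}  M _    = refl
IsDiagonal⇒‖‖²≡‖diag‖² {suc k} M diag = begin
  ‖ M ‖²                           ≡⟨ ‖‖²-split M ⟩
  ‖diag M ‖² + ∑ (offDiagonal² M)  ≡⟨ cong (_+_ ‖diag M ‖²) ∑offDiagonal²≡0 ⟩
  ‖diag M ‖² + 0ℤ                  ≡⟨ ℤ.+-identityʳ ‖diag M ‖² ⟩
  ‖diag M ‖²                       ∎
  where
  open ≡-Reasoning
  offDiagonal²≡0 : ∀ i → offDiagonal² M i ≡ 0ℤ
  offDiagonal²≡0 i = trans (∑-cong (λ j → cong _² (diag (punchInᵢ≢i i j ∘ sym)))) (∑-zero {k})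
  ∑offDiagonal²≡0 : ∑ (offDiagonal² M) ≡ 0ℤ
  ∑offDiagonal²≡0 = trans (∑-cong offDiagonal²≡0) (∑-zero {suc k})

‖‖²≡‖diag‖²⇒IsDiagonal : ∀ {k} (M : Matrix k) → ‖ M ‖² ≡ ‖diag M ‖² → IsDiagonal M
‖‖²≡‖diag‖²⇒IsDiagonal {suc k} M ‖M‖²≡‖diagM‖² {i} {j} i≢j =
  i²≡0⇒i≡0 (M i j) (subst (λ j → M i j ² ≡ 0ℤ) (punchIn-punchOut i≢j) Mᵢⱼ²≡0)
  where
  ∑offDiagonal²≡0 : ∑ (offDiagonal² M) ≡ 0ℤ
  ∑offDiagonal²≡0 = identityʳ-unique ‖diag M ‖² _ (trans (sym (‖‖²-split M)) ‖M‖²≡‖diagM‖²)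
  offDiagonal²ᵢ≡0 : offDiagonal² M i ≡ 0ℤ
  offDiagonal²ᵢ≡0 = ∑-nonneg-≡0⇒≡0 (offDiagonal² M)
    (λ i → ∑-nonneg (removeAt (λ j → M i j ²) i) (λ j → 0≤i² (M i (punchIn i j))))
    ∑offDiagonal²≡0 i
  Mᵢⱼ²≡0 : M i (punchIn i (punchOut i≢j)) ² ≡ 0ℤ
  Mᵢⱼ²≡0 = ∑-nonneg-≡0⇒≡0 (removeAt (λ j → M i j ²) i) (λ j → 0≤i² (M i (punchIn i j)))
    offDiagonal²ᵢ≡0 (punchOut i≢j)

‖gram-transpose‖² : ∀ {k n} (A : Fin k → Vector ℤ n) → ‖ gram (flip A) ‖² ≡ ‖ gram A ‖²
‖gram-transpose‖² A = begin
  ∑ (λ i → ∑ (λ j → ⟨ flip A i , flip A j ⟩ ²))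
    ≡⟨ ∑-cong (λ i → ∑-cong (λ j → ∑*∑ (λ ℓ → A ℓ i * A ℓ j) (λ ℓ → A ℓ i * A ℓ j))) ⟩
  ∑ (λ i → ∑ (λ j → ∑ (λ ℓ → ∑ (λ ℓ′ → (A ℓ i * A ℓ j) * (A ℓ′ i * A ℓ′ j)))))
    ≡⟨ ∑∑-comm (λ i j ℓ ℓ′ → (A ℓ i * A ℓ j) * (A ℓ′ i * A ℓ′ j)) ⟩
  ∑ (λ ℓ → ∑ (λ ℓ′ → ∑ (λ i → ∑ (λ j → (A ℓ i * A ℓ j) * (A ℓ′ i * A ℓ′ j)))))
    ≡⟨ ∑-cong (λ ℓ → ∑-cong (λ ℓ′ → ∑-cong (λ i → ∑-cong (λ j →
         interchange (A ℓ i) (A ℓ j) (A ℓ′ i) (A ℓ′ j))))) ⟩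
  ∑ (λ ℓ → ∑ (λ ℓ′ → ∑ (λ i → ∑ (λ j → (A ℓ i * A ℓ′ i) * (A ℓ j * A ℓ′ j)))))
    ≡⟨ ∑-cong (λ ℓ → ∑-cong (λ ℓ′ → ∑*∑ (λ i → A ℓ i * A ℓ′ i) (λ j → A ℓ j * A ℓ′ j))) ⟨
  ∑ (λ ℓ → ∑ (λ ℓ′ → ⟨ A ℓ , A ℓ′ ⟩ ²)) ∎
  where open ≡-Reasoning

IsHadamard⇒gram-IsDiagonal : ∀ {n} {H : Matrix n} → IsHadamard n H → IsDiagonal (gram H)
IsHadamard⇒gram-IsDiagonal {H = H} (_ , HHᵀ) {ℓ} {ℓ′} ℓ≢ℓ′ with ℓ ≟ ℓ′ | HHᵀ ℓ ℓ′
... | yes ℓ≡ℓ′ | _          = contradiction ℓ≡ℓ′ ℓ≢ℓ′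
... | no _     | ⟨Hℓ,Hℓ′⟩≡0 = ⟨Hℓ,Hℓ′⟩≡0

IsHadamard⇒gram-transpose-IsDiagonal : ∀ {n} {H : Matrix n} → IsHadamard n H →
  IsDiagonal (gram (flip H))
IsHadamard⇒gram-transpose-IsDiagonal {n} {H} had@(pm , _) =
  ‖‖²≡‖diag‖²⇒IsDiagonal (gram (flip H)) (begin
  ‖ gram (flip H) ‖²      ≡⟨ ‖gram-transpose‖² H ⟩
  ‖ gram H ‖²             ≡⟨ IsDiagonal⇒‖‖²≡‖diag‖² (gram H) (IsHadamard⇒gram-IsDiagonal had) ⟩
  ‖diag gram H ‖²         ≡⟨ ∑-cong (λ i → cong _² (trans (rowNorm i) (sym (columnNorm i)))) ⟩
  ‖diag gram (flip H) ‖²  ∎)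
  where
  open ≡-Reasoning
  rowNorm : ∀ ℓ → ⟨ H ℓ , H ℓ ⟩ ≡ + n
  rowNorm ℓ = IsPM1⇒⟨u,u⟩≡n (H ℓ) (pm ℓ)
  columnNorm : ∀ k → ⟨ flip H k , flip H k ⟩ ≡ + n
  columnNorm k = IsPM1⇒⟨u,u⟩≡n (flip H k) (flip pm k)

tensorPower : ∀ {n} d → Vector ℤ n → Hypercube n d
tensorPower d u x = ∏ {d} (λ j → u (x j))

∑cells-cong : ∀ {n d} {f g : Hypercube n d} → (∀ x → f x ≡ g x) → ∑cells f ≡ ∑cells g
∑cells-cong {d = zero}  f≗g = f≗g _
∑cells-cong {d = suc d} f≗g = ∑-cong (λ a → ∑cells-cong (λ y → f≗g (insertAt y zero a)))

∑cells-*ˡ : ∀ {n d} c (f : Hypercube n d) → c * ∑cells f ≡ ∑cells (λ x → c * f x)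
∑cells-*ˡ {d = zero}  c f = refl
∑cells-*ˡ {d = suc d} c f =
  trans (∑-*ˡ c (λ a → ∑cells (λ y → f (insertAt y zero a))))
        (∑-cong (λ a → ∑cells-*ˡ c (λ y → f (insertAt y zero a))))

scale-·-scale : ∀ {n d} c c′ (A B : Hypercube n d) →
  (λ x → c * A x) · (λ x → c′ * B x) ≡ (c * c′) * (A · B)
scale-·-scale c c′ A B =
  trans (∑cells-cong (λ x → interchange c (A x) c′ (B x))) (sym (∑cells-*ˡ (c * c′) (λ x → A x * B x)))

slice-tensorPower : ∀ {n m} (u : Vector ℤ n) i a (y : Fin m → Fin n) →
  slice (tensorPower (suc m) u) i a y ≡ u a * tensorPower m u y
slice-tensorPower             u zero    a y = refl
slice-tensorPower {m = suc m} u (suc i) a y =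
  trans (cong (_*_ (u (y zero))) (slice-tensorPower u i a (y ∘ suc)))
        (x∙yz≈y∙xz (u (y zero)) (u a) (tensorPower m u (y ∘ suc)))

slice-tensorPower-·-tensorPower : ∀ {n m} (u v : Vector ℤ n) i a b →
  slice (tensorPower (suc m) u) i a · slice (tensorPower (suc m) v) i b ≡
  (u a * v b) * (tensorPower m u · tensorPower m v)
slice-tensorPower-·-tensorPower {m = m} u v i a b = trans
  (∑cells-cong (λ y → cong₂ _*_ (slice-tensorPower u i a y) (slice-tensorPower v i b y)))
  (scale-·-scale (u a) (v b) (tensorPower m u) (tensorPower m v))

tensorPower-· : ∀ {n} d (u v : Vector ℤ n) → tensorPower d u · tensorPower d v ≡ ⟨ u , v ⟩ ^ d
tensorPower-· zero    u v = refl
tensorPower-· (suc d) u v = begin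
  tensorPower (suc d) u · tensorPower (suc d) v
    ≡⟨ ∑-cong (λ a → slice-tensorPower-·-tensorPower {m = d} u v zero a a) ⟩
  ∑ (λ a → (u a * v a) * (tensorPower d u · tensorPower d v))
    ≡⟨ ∑-*ʳ _ (λ a → u a * v a) ⟨
  ⟨ u , v ⟩ * (tensorPower d u · tensorPower d v)
    ≡⟨ cong (_*_ ⟨ u , v ⟩) (tensorPower-· d u v) ⟩
  ⟨ u , v ⟩ ^ suc d ∎
  where open ≡-Reasoning

slice-tensorPower-· : ∀ {n} m (u v : Vector ℤ n) i a b →
  slice (tensorPower (suc m) u) i a · slice (tensorPower (suc m) v) i b ≡ (u a * v b) * ⟨ u , v ⟩ ^ m
slice-tensorPower-· m u v i a b =
  trans (slice-tensorPower-·-tensorPower u v i a b) (cong (_*_ (u a * v b)) (tensorPower-· m u v))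

slice-tensorPower-·≡0 : ∀ {n} m (u v : Vector ℤ n) → ⟨ u , v ⟩ ≡ 0ℤ → ∀ i a b →
  slice (tensorPower (suc (suc m)) u) i a · slice (tensorPower (suc (suc m)) v) i b ≡ 0ℤ
slice-tensorPower-·≡0 m u v ⟨u,v⟩≡0 i a b = begin
  slice (tensorPower (suc (suc m)) u) i a · slice (tensorPower (suc (suc m)) v) i b
    ≡⟨ slice-tensorPower-· (suc m) u v i a b ⟩
  (u a * v b) * ⟨ u , v ⟩ ^ suc m  ≡⟨ cong (λ g → (u a * v b) * g ^ suc m) ⟨u,v⟩≡0 ⟩
  (u a * v b) * 0ℤ                 ≡⟨ ℤ.*-zeroʳ (u a * v b) ⟩
  0ℤ                               ∎
  where open ≡-Reasoning

∑-slice-productCube-· : ∀ {n} m (H : Matrix n) c → (∀ ℓ → ⟨ H ℓ , H ℓ ⟩ ≡ c) → ∀ i a b →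
  ∑ (λ ℓ → slice (productCube (suc m) H ℓ) i a · slice (productCube (suc m) H ℓ) i b) ≡
  ⟨ flip H a , flip H b ⟩ * c ^ m
∑-slice-productCube-· m H c ⟨Hℓ,Hℓ⟩≡c i a b = begin
  ∑ (λ ℓ → slice (productCube (suc m) H ℓ) i a · slice (productCube (suc m) H ℓ) i b)
    ≡⟨ ∑-cong (λ ℓ → slice-tensorPower-· m (H ℓ) (H ℓ) i a b) ⟩
  ∑ (λ ℓ → (H ℓ a * H ℓ b) * ⟨ H ℓ , H ℓ ⟩ ^ m)
    ≡⟨ ∑-cong (λ ℓ → cong (λ g → (H ℓ a * H ℓ b) * g ^ m) (⟨Hℓ,Hℓ⟩≡c ℓ)) ⟩
  ∑ (λ ℓ → (H ℓ a * H ℓ b) * c ^ m)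
    ≡⟨ ∑-*ʳ (c ^ m) (λ ℓ → H ℓ a * H ℓ b) ⟨
  ⟨ flip H a , flip H b ⟩ * c ^ m ∎
  where open ≡-Reasoning

tensorPower-≢ : ∀ {n} d (u v : Vector ℤ n) → ⟨ u , u ⟩ ≢ 0ℤ → ⟨ u , v ⟩ ≡ 0ℤ →
  tensorPower (suc d) u ≢ tensorPower (suc d) v
tensorPower-≢ d u v ⟨u,u⟩≢0 ⟨u,v⟩≡0 u⊗≡v⊗ = ⟨u,u⟩≢0 (ℤ.i^n≡0⇒i≡0 ⟨ u , u ⟩ (suc d) (begin
  ⟨ u , u ⟩ ^ suc d                              ≡⟨ tensorPower-· (suc d) u u ⟨
  tensorPower (suc d) u · tensorPower (suc d) u  ≡⟨ cong (tensorPower (suc d) u ·_) u⊗≡v⊗ ⟩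
  tensorPower (suc d) u · tensorPower (suc d) v  ≡⟨ tensorPower-· (suc d) u v ⟩
  ⟨ u , v ⟩ ^ suc d                              ≡⟨ cong (_^ suc d) ⟨u,v⟩≡0 ⟩
  0ℤ                                             ∎))
  where open ≡-Reasoning

Fin⇒+n≢0 : ∀ {n} → Fin n → + n ≢ 0ℤ
Fin⇒+n≢0 {suc n} _ ()

lemma5p4 : (n : ℕ) (H : Matrix n) → IsHadamard n H →
    (m : ℕ) → 1 ≤ m →
    IsOrthogonalFamily n m (productCube (suc m) H)
lemma5p4 n H had zero ()
lemma5p4 n H had@(pm , _) (suc m) _ =
    (λ ℓ x → IsPM1-∏ (λ j → H ℓ (x j)) (λ j → pm ℓ (x j)))
  , (λ ℓ ℓ′ ℓ≢ℓ′ → slice-tensorPower-·≡0 m (H ℓ) (H ℓ′) (rows ℓ≢ℓ′))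
  , (λ ℓ ℓ′ ℓ≢ℓ′ → tensorPower-≢ (suc m) (H ℓ) (H ℓ′)
                     (Fin⇒+n≢0 ℓ ∘ trans (sym (rowNorm ℓ))) (rows ℓ≢ℓ′))
  , (λ i a b a≢b → trans (∑-slice-productCube-· (suc m) H (+ n) rowNorm i a b)
                         (cong (_* (+ n) ^ suc m) (columns a≢b)))
  where
  rows : IsDiagonal (gram H)
  rows = IsHadamard⇒gram-IsDiagonal had
  columns : IsDiagonal (gram (flip H))
  columns = IsHadamard⇒gram-transpose-IsDiagonal had
  rowNorm : ∀ ℓ → ⟨ H ℓ , H ℓ ⟩ ≡ + n
  rowNorm ℓ = IsPM1⇒⟨u,u⟩≡n (H ℓ) (pm ℓ)
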